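{- Let $X$ be a dcpo. There are bijective correspondences between: (i) Scott continuous maps $f\colon X\to 3$; (ii) pairs of Scott continuous maps $g_1,g_2\colon X\to 2$ with $g_1\ge g_2$ pointwise; (iii) pairs $(U_1,U_2)\in\mathcal{O}(X)\ltimes\mathcal{O}(X)$, i.e. Scott open subsets with $U_1\supseteq U_2$. As a result there is an isomorphism $$\mathbf{Dcpo}(X,3)\;\cong\;\mathcal{O}(X)\ltimes\mathcal{O}(X),\qquad f\longmapsto\big(\{x\mid f(x)\neq 0\},\;\{x\mid f(x)=1\}\big),$$ and this is an isomorphism of Plotkin algebras, where $\mathbf{Dcpo}(X,3)$ carries the pointwise Plotkin algebra structure inherited from $3$.
   Context: $\mathbf{Dcpo}(X,Y)$ is the set of Scott continuous maps (preserving directed joins). $2=\{0<1\}$. $3=\{0,\bowtie,1\}$ with $0\le\bowtie\le 1$. A Plotkin algebra is a poset with least and greatest elements $0,1$, a binary operation $\amalg$ that is idempotent, commutative, associative and monotone, and a special element $\bowtie$ that is absorbing for $\amalg$. On $3$: $a\amalg b=0$ if $a=b=0$, $a\amalg b=1$ if $a=b=1$, and $a\amalg b=\bowtie$ otherwise, with special element $\bowtie$. $\mathcal{O}(X)$ is the frame of Scott open subsets of $X$, and for a frame $Y$, $Y\ltimes Y=\{(x,y)\in Y\times Y\mid x\ge y\}$ with product order, $(x,y)\amalg(x',y')=(x\vee x',y\wedge y')$, $\bowtie=(1,0)$, bottom $(0,0)$ and top $(1,1)$. -}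

module Defs where

open import Level using (Level; _⊔_; Lift; lift; lower) renaming (suc to lsuc)
open import Data.Bool using (Bool; true; false; _∨_; _∧_)
open import Data.Bool.Properties using () renaming (≤-poset to 𝟚-poset)
open import Data.Product using (Σ; ∃; _×_; _,_; proj₁; proj₂)
open import Data.Empty using (⊥; ⊥-elim)
open import Relation.Binary.Bundles using (Poset)
open import Relation.Binary.PropositionalEquality using (_≡_; refl; sym; trans)
open import Relation.Nullary using (¬_)

module _ {c ℓ₁ ℓ₂} (P : Poset c ℓ₁ ℓ₂) where
  open Poset P

  IsUpperBound : ∀ {ι} {I : Set ι} → (I → Carrier) → Carrier → Set (ι ⊔ ℓ₂)
  IsUpperBound d u = ∀ i → d i ≤ u

  IsLub : ∀ {ι} {I : Set ι} → (I → Carrier) → Carrier → Set (ι ⊔ c ⊔ ℓ₂)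
  IsLub d s = IsUpperBound d s × (∀ u → IsUpperBound d u → s ≤ u)

  IsDirected : ∀ {ι} {I : Set ι} → (I → Carrier) → Set (ι ⊔ ℓ₂)
  IsDirected {I = I} d = I × (∀ i j → Σ I (λ k → d i ≤ d k × d j ≤ d k))

record Dcpo c ℓ₁ ℓ₂ ι : Set (lsuc (c ⊔ ℓ₁ ⊔ ℓ₂ ⊔ ι)) where
  field
    poset : Poset c ℓ₁ ℓ₂
  open Poset poset public
  field
    dsup : ∀ {I : Set ι} (d : I → Carrier) → IsDirected poset d → Σ Carrier (IsLub poset d)

ScottContinuous : ∀ {c ℓ₁ ℓ₂ ι c' ℓ₁' ℓ₂'} (X : Dcpo c ℓ₁ ℓ₂ ι) (Q : Poset c' ℓ₁' ℓ₂') →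
                  (Dcpo.Carrier X → Poset.Carrier Q) → Set _
ScottContinuous {ι = ι} X Q f =
  ∀ {I : Set ι} (d : I → Carrier) → IsDirected poset d →
  ∀ s → IsLub poset d s → IsLub Q (λ i → f (d i)) (f s)
  where open Dcpo X

-- The poset 2 = {0 < 1}: Bool with false ≤ true (stdlib's ≤-poset, named 𝟚-poset)

data Three : Set where
  zero₃ bowtie one₃ : Three

infix 4 _≤₃_
data _≤₃_ : Three → Three → Set where
  0≤0 : zero₃ ≤₃ zero₃
  0≤⋈ : zero₃ ≤₃ bowtie
  0≤1 : zero₃ ≤₃ one₃
  ⋈≤⋈ : bowtie ≤₃ bowtie
  ⋈≤1 : bowtie ≤₃ one₃
  1≤1 : one₃ ≤₃ one₃

≤₃-refl : ∀ {x} → x ≤₃ x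
≤₃-refl {zero₃} = 0≤0
≤₃-refl {bowtie} = ⋈≤⋈
≤₃-refl {one₃} = 1≤1

≤₃-trans : ∀ {x y z} → x ≤₃ y → y ≤₃ z → x ≤₃ z
≤₃-trans 0≤0 q = q
≤₃-trans 0≤⋈ ⋈≤⋈ = 0≤⋈
≤₃-trans 0≤⋈ ⋈≤1 = 0≤1
≤₃-trans 0≤1 1≤1 = 0≤1
≤₃-trans ⋈≤⋈ q = q
≤₃-trans ⋈≤1 1≤1 = ⋈≤1
≤₃-trans 1≤1 q = q

≤₃-antisym : ∀ {x y} → x ≤₃ y → y ≤₃ x → x ≡ y
≤₃-antisym 0≤0 _ = refl
≤₃-antisym ⋈≤⋈ _ = refl
≤₃-antisym 1≤1 _ = refl
≤₃-antisym 0≤⋈ ()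
≤₃-antisym 0≤1 ()
≤₃-antisym ⋈≤1 ()

𝟛-poset : Poset Level.zero Level.zero Level.zero
𝟛-poset = record
  { Carrier = Three ; _≈_ = _≡_ ; _≤_ = _≤₃_
  ; isPartialOrder = record
    { isPreorder = record
      { isEquivalence = record { refl = refl ; sym = sym ; trans = trans }
      ; reflexive = λ { refl → ≤₃-refl }
      ; trans = ≤₃-trans }
    ; antisym = ≤₃-antisym } }

infixr 6 _⨿₃_
_⨿₃_ : Three → Three → Three
zero₃ ⨿₃ zero₃ = zero₃
one₃ ⨿₃ one₃ = one₃
zero₃ ⨿₃ bowtie = bowtie
zero₃ ⨿₃ one₃ = bowtie
bowtie ⨿₃ _ = bowtie
one₃ ⨿₃ zero₃ = bowtie
one₃ ⨿₃ bowtie = bowtie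

⨿₃-mono : ∀ {x x' y y'} → x ≤₃ x' → y ≤₃ y' → (x ⨿₃ y) ≤₃ (x' ⨿₃ y')
⨿₃-mono 0≤0 0≤0 = 0≤0
⨿₃-mono 0≤0 0≤⋈ = 0≤⋈
⨿₃-mono 0≤0 0≤1 = 0≤⋈
⨿₃-mono 0≤0 ⋈≤⋈ = ⋈≤⋈
⨿₃-mono 0≤0 ⋈≤1 = ⋈≤⋈
⨿₃-mono 0≤0 1≤1 = ⋈≤⋈
⨿₃-mono 0≤⋈ 0≤0 = 0≤⋈
⨿₃-mono 0≤⋈ 0≤⋈ = 0≤⋈
⨿₃-mono 0≤⋈ 0≤1 = 0≤⋈
⨿₃-mono 0≤⋈ ⋈≤⋈ = ⋈≤⋈
⨿₃-mono 0≤⋈ ⋈≤1 = ⋈≤⋈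
⨿₃-mono 0≤⋈ 1≤1 = ⋈≤⋈
⨿₃-mono 0≤1 0≤0 = 0≤⋈
⨿₃-mono 0≤1 0≤⋈ = 0≤⋈
⨿₃-mono 0≤1 0≤1 = 0≤1
⨿₃-mono 0≤1 ⋈≤⋈ = ⋈≤⋈
⨿₃-mono 0≤1 ⋈≤1 = ⋈≤1
⨿₃-mono 0≤1 1≤1 = ⋈≤1
⨿₃-mono ⋈≤⋈ 0≤0 = ⋈≤⋈
⨿₃-mono ⋈≤⋈ 0≤⋈ = ⋈≤⋈
⨿₃-mono ⋈≤⋈ 0≤1 = ⋈≤⋈
⨿₃-mono ⋈≤⋈ ⋈≤⋈ = ⋈≤⋈
⨿₃-mono ⋈≤⋈ ⋈≤1 = ⋈≤⋈
⨿₃-mono ⋈≤⋈ 1≤1 = ⋈≤⋈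
⨿₃-mono ⋈≤1 0≤0 = ⋈≤⋈
⨿₃-mono ⋈≤1 0≤⋈ = ⋈≤⋈
⨿₃-mono ⋈≤1 0≤1 = ⋈≤1
⨿₃-mono ⋈≤1 ⋈≤⋈ = ⋈≤⋈
⨿₃-mono ⋈≤1 ⋈≤1 = ⋈≤1
⨿₃-mono ⋈≤1 1≤1 = ⋈≤1
⨿₃-mono 1≤1 0≤0 = ⋈≤⋈
⨿₃-mono 1≤1 0≤⋈ = ⋈≤⋈
⨿₃-mono 1≤1 0≤1 = ⋈≤1
⨿₃-mono 1≤1 ⋈≤⋈ = ⋈≤⋈
⨿₃-mono 1≤1 ⋈≤1 = ⋈≤1
⨿₃-mono 1≤1 1≤1 = 1≤1

nonzero₃ : Three → Bool
nonzero₃ zero₃ = false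
nonzero₃ _ = true

isOne₃ : Three → Bool
isOne₃ one₃ = true
isOne₃ _ = false

-- Scott open subsets.  A subset of X is represented by its characteristic
-- function X → Bool (membership: U x ≡ true).

module _ {c ℓ₁ ℓ₂ ι} (X : Dcpo c ℓ₁ ℓ₂ ι) where
  open Dcpo X

  record IsScottOpen (U : Carrier → Bool) : Set (c ⊔ ℓ₁ ⊔ ℓ₂ ⊔ lsuc ι) where
    field
      upper : ∀ {x y} → x ≤ y → U x ≡ true → U y ≡ true
      inaccessible : ∀ {I : Set ι} (d : I → Carrier) → IsDirected poset d →
                     ∀ s → IsLub poset d s → U s ≡ true → Σ I (λ i → U (d i) ≡ true)

module _ {c ℓ₁ ℓ₂ ι c' ℓ₁' ℓ₂'} (X : Dcpo c ℓ₁ ℓ₂ ι) (Q : Poset c' ℓ₁' ℓ₂') where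
  private
    module X = Dcpo X
    module Q = Poset Q

  continuous⇒monotone : ∀ {f} → ScottContinuous X Q f → ∀ {x y} → x X.≤ y → f x Q.≤ f y
  continuous⇒monotone {f} fc {x} {y} x≤y =
    proj₁ (fc d dir y lub) (lift false)
    where
      d : Lift ι Bool → X.Carrier
      d (lift false) = x
      d (lift true) = y
      d≤y : ∀ i → d i X.≤ y
      d≤y (lift false) = x≤y
      d≤y (lift true) = X.refl
      dir : IsDirected X.poset d
      dir = lift true , λ i j → lift true , d≤y i , d≤y j
      lub : IsLub X.poset d y
      lub = d≤y , λ u ub → ub (lift true)

  const-continuous : ∀ k → ScottContinuous X Q (λ _ → k)
  const-continuous k d (i₀ , _) s _ = (λ _ → Q.refl) , λ u ub → ub i₀

private
  ≤1 : ∀ {x} → x ≤₃ one₃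
  ≤1 {zero₃} = 0≤1
  ≤1 {bowtie} = ⋈≤1
  ≤1 {one₃} = 1≤1

  ⨿≤0ˡ : ∀ {x y} → (x ⨿₃ y) ≤₃ zero₃ → x ≤₃ zero₃
  ⨿≤0ˡ {zero₃} {zero₃} p = 0≤0
  ⨿≤0ˡ {zero₃} {bowtie} ()
  ⨿≤0ˡ {zero₃} {one₃} ()
  ⨿≤0ˡ {bowtie} ()
  ⨿≤0ˡ {one₃} {zero₃} ()
  ⨿≤0ˡ {one₃} {bowtie} ()
  ⨿≤0ˡ {one₃} {one₃} ()

  ⨿≤0ʳ : ∀ {x y} → (x ⨿₃ y) ≤₃ zero₃ → y ≤₃ zero₃
  ⨿≤0ʳ {zero₃} {zero₃} p = 0≤0
  ⨿≤0ʳ {zero₃} {bowtie} ()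
  ⨿≤0ʳ {zero₃} {one₃} ()
  ⨿≤0ʳ {bowtie} ()
  ⨿≤0ʳ {one₃} {zero₃} ()
  ⨿≤0ʳ {one₃} {bowtie} ()
  ⨿≤0ʳ {one₃} {one₃} ()

  1≤⇒≡ : ∀ {x} → one₃ ≤₃ x → x ≡ one₃
  1≤⇒≡ 1≤1 = refl

  ≢1⇒≤⋈ : ∀ x → (x ≡ one₃ → ⊥) → x ≤₃ bowtie
  ≢1⇒≤⋈ zero₃ _ = 0≤⋈
  ≢1⇒≤⋈ bowtie _ = ⋈≤⋈
  ≢1⇒≤⋈ one₃ ne = ⊥-elim (ne refl)

module _ {c ℓ₁ ℓ₂ ι} (X : Dcpo c ℓ₁ ℓ₂ ι) where
  private module X = Dcpo X

  private
    lub1 : ∀ {I : Set ι} (e : I → Three) → IsLub 𝟛-poset e one₃ →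
           ¬ ¬ Σ I (λ i → e i ≡ one₃)
    lub1 e (_ , least) no with least bowtie (λ i → ≢1⇒≤⋈ (e i) (λ eq → no (i , eq)))
    ... | ()

  ⨿-continuous : ∀ {f g} → ScottContinuous X 𝟛-poset f → ScottContinuous X 𝟛-poset g →
                 ScottContinuous X 𝟛-poset (λ x → f x ⨿₃ g x)
  ⨿-continuous {f} {g} fc gc d dir s lub =
    (λ i → ⨿₃-mono (proj₁ (fc d dir s lub) i) (proj₁ (gc d dir s lub) i)) , least
    where
      least : ∀ u → IsUpperBound 𝟛-poset (λ i → f (d i) ⨿₃ g (d i)) u → (f s ⨿₃ g s) ≤₃ u
      least one₃ ub = ≤1
      least zero₃ ub =
        ⨿₃-mono (proj₂ (fc d dir s lub) zero₃ (λ i → ⨿≤0ˡ (ub i)))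
                (proj₂ (gc d dir s lub) zero₃ (λ i → ⨿≤0ʳ (ub i)))
      least bowtie ub with f s in eqf | g s in eqg
      ... | zero₃ | zero₃ = 0≤⋈
      ... | zero₃ | bowtie = ⋈≤⋈
      ... | zero₃ | one₃ = ⋈≤⋈
      ... | bowtie | _ = ⋈≤⋈
      ... | one₃ | zero₃ = ⋈≤⋈
      ... | one₃ | bowtie = ⋈≤⋈
      ... | one₃ | one₃ = ⊥-elim
        (lub1 (λ i → f (d i)) (subst′ eqf (fc d dir s lub)) λ { (i , fi) →
         lub1 (λ i → g (d i)) (subst′ eqg (gc d dir s lub)) λ { (j , gj) →
           let (k , ik , jk) = proj₂ dir i j
               fk = 1≤⇒≡ (subst-l fi (continuous⇒monotone X 𝟛-poset fc ik))
               gk = 1≤⇒≡ (subst-l gj (continuous⇒monotone X 𝟛-poset gc jk))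
           in bad (subst-both fk gk (ub k)) } })
        where
          subst′ : ∀ {I : Set ι} {e : I → Three} {a b} → a ≡ b → IsLub 𝟛-poset e a → IsLub 𝟛-poset e b
          subst′ refl p = p
          subst-l : ∀ {a b c} → a ≡ b → a ≤₃ c → b ≤₃ c
          subst-l refl p = p
          subst-both : ∀ {a b} → a ≡ one₃ → b ≡ one₃ → (a ⨿₃ b) ≤₃ bowtie → (one₃ ⨿₃ one₃) ≤₃ bowtie
          subst-both refl refl p = p
          bad : (one₃ ⨿₃ one₃) ≤₃ bowtie → ⊥
          bad ()

  open IsScottOpen

  ∅-open : IsScottOpen X (λ _ → false)
  ∅-open = record { upper = λ _ p → p ; inaccessible = λ _ _ _ _ () }

  X-open : IsScottOpen X (λ _ → true)
  X-open = record { upper = λ _ _ → refl ; inaccessible = λ _ (i₀ , _) _ _ _ → i₀ , refl }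

  private
    ∨-introˡ : ∀ {a} b → a ≡ true → a ∨ b ≡ true
    ∨-introˡ _ refl = refl
    ∨-introʳ : ∀ a {b} → b ≡ true → a ∨ b ≡ true
    ∨-introʳ false refl = refl
    ∨-introʳ true _ = refl
    ∧-elimˡ : ∀ a {b} → a ∧ b ≡ true → a ≡ true
    ∧-elimˡ true _ = refl
    ∧-elimʳ : ∀ a {b} → a ∧ b ≡ true → b ≡ true
    ∧-elimʳ true p = p
    ∧-intro : ∀ {a b} → a ≡ true → b ≡ true → a ∧ b ≡ true
    ∧-intro refl refl = refl

  ∪-open : ∀ {U V} → IsScottOpen X U → IsScottOpen X V → IsScottOpen X (λ x → U x ∨ V x)
  ∪-open {U} {V} uo vo = record { upper = up ; inaccessible = inacc }
    where
      up : ∀ {x y} → x X.≤ y → U x ∨ V x ≡ true → U y ∨ V y ≡ true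
      up {x} {y} x≤y p with U x in eq
      ... | true = ∨-introˡ (V y) (upper uo x≤y eq)
      ... | false = ∨-introʳ (U y) (upper vo x≤y p)
      inacc : ∀ {I : Set ι} (d : I → X.Carrier) → IsDirected X.poset d →
              ∀ s → IsLub X.poset d s → U s ∨ V s ≡ true → Σ I (λ i → U (d i) ∨ V (d i) ≡ true)
      inacc d dir s lub p with U s in eq
      ... | true = let (i , q) = inaccessible uo d dir s lub eq in i , ∨-introˡ (V (d i)) q
      ... | false = let (i , q) = inaccessible vo d dir s lub p in i , ∨-introʳ (U (d i)) q

  ∩-open : ∀ {U V} → IsScottOpen X U → IsScottOpen X V → IsScottOpen X (λ x → U x ∧ V x)
  ∩-open {U} {V} uo vo = record { upper = up ; inaccessible = inacc }
    where
      up : ∀ {x y} → x X.≤ y → U x ∧ V x ≡ true → U y ∧ V y ≡ true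
      up {x} x≤y p = ∧-intro (upper uo x≤y (∧-elimˡ (U x) p)) (upper vo x≤y (∧-elimʳ (U x) p))
      inacc : ∀ {I : Set ι} (d : I → X.Carrier) → IsDirected X.poset d →
              ∀ s → IsLub X.poset d s → U s ∧ V s ≡ true → Σ I (λ i → U (d i) ∧ V (d i) ≡ true)
      inacc d dir s lub p =
        let (i , ui) = inaccessible uo d dir s lub (∧-elimˡ (U s) p)
            (j , vj) = inaccessible vo d dir s lub (∧-elimʳ (U s) p)
            (k , ik , jk) = proj₂ dir i j
        in k , ∧-intro (upper uo ik ui) (upper vo jk vj)

  ∪∩-incl : ∀ {U₁ U₂ V₁ V₂ : X.Carrier → Bool} →
            (∀ x → U₂ x ≡ true → U₁ x ≡ true) → (∀ x → V₂ x ≡ true → V₁ x ≡ true) →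
            ∀ x → U₂ x ∧ V₂ x ≡ true → U₁ x ∨ V₁ x ≡ true
  ∪∩-incl {U₁} {U₂} {V₁} {V₂} iu iv x p = ∨-introˡ (V₁ x) (iu x (∧-elimˡ (U₂ x) p))

record PlotkinSig c ℓ₁ ℓ₂ : Set (lsuc (c ⊔ ℓ₁ ⊔ ℓ₂)) where
  infix 4 _≈_ _≤_
  infixr 6 _⨿_
  field
    Carrier : Set c
    _≈_ : Carrier → Carrier → Set ℓ₁
    _≤_ : Carrier → Carrier → Set ℓ₂
    𝟘 𝟙 ⋈ : Carrier
    _⨿_ : Carrier → Carrier → Carrier

record Bijective {a b ℓa ℓb} {A : Set a} {B : Set b}
                 (_≈A_ : A → A → Set ℓa) (_≈B_ : B → B → Set ℓb) (φ : A → B) : Set (a ⊔ b ⊔ ℓa ⊔ ℓb) where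
  field
    cong : ∀ {x y} → x ≈A y → φ x ≈B φ y
    injective : ∀ {x y} → φ x ≈B φ y → x ≈A y
    surjective : ∀ z → Σ A (λ x → φ x ≈B z)

record IsPlotkinIso {c ℓ₁ ℓ₂ c' ℓ₁' ℓ₂'} (A : PlotkinSig c ℓ₁ ℓ₂) (B : PlotkinSig c' ℓ₁' ℓ₂')
                    (φ : PlotkinSig.Carrier A → PlotkinSig.Carrier B) : Set (c ⊔ ℓ₁ ⊔ ℓ₂ ⊔ c' ⊔ ℓ₁' ⊔ ℓ₂') where
  private
    module A = PlotkinSig A
    module B = PlotkinSig B
  field
    bijective : Bijective A._≈_ B._≈_ φ
    monotone : ∀ {x y} → x A.≤ y → φ x B.≤ φ y
    reflecting : ∀ {x y} → φ x B.≤ φ y → x A.≤ y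
    pres-𝟘 : φ A.𝟘 B.≈ B.𝟘
    pres-𝟙 : φ A.𝟙 B.≈ B.𝟙
    pres-⋈ : φ A.⋈ B.≈ B.⋈
    pres-⨿ : ∀ x y → φ (x A.⨿ y) B.≈ (φ x B.⨿ φ y)

module _ {c ℓ₁ ℓ₂ ι} (X : Dcpo c ℓ₁ ℓ₂ ι) where
  private module X = Dcpo X

  record Map3 : Set (c ⊔ ℓ₁ ⊔ ℓ₂ ⊔ lsuc ι) where
    constructor mkMap3
    field
      fun : X.Carrier → Three
      continuous : ScottContinuous X 𝟛-poset fun

  record Pair2 : Set (c ⊔ ℓ₁ ⊔ ℓ₂ ⊔ lsuc ι) where
    constructor mkPair2
    field
      g₁ g₂ : X.Carrier → Bool
      g₁-continuous : ScottContinuous X 𝟚-poset g₁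
      g₂-continuous : ScottContinuous X 𝟚-poset g₂
      g₂≤g₁ : ∀ x → Poset._≤_ 𝟚-poset (g₂ x) (g₁ x)

  record OpenPair : Set (c ⊔ ℓ₁ ⊔ ℓ₂ ⊔ lsuc ι) where
    constructor mkOpenPair
    field
      U₁ U₂ : X.Carrier → Bool
      U₁-open : IsScottOpen X U₁
      U₂-open : IsScottOpen X U₂
      U₂⊆U₁ : ∀ x → U₂ x ≡ true → U₁ x ≡ true

  _≈Map3_ : Map3 → Map3 → Set c
  f ≈Map3 g = ∀ x → Map3.fun f x ≡ Map3.fun g x

  _≈Pair2_ : Pair2 → Pair2 → Set c
  p ≈Pair2 q = (∀ x → Pair2.g₁ p x ≡ Pair2.g₁ q x) × (∀ x → Pair2.g₂ p x ≡ Pair2.g₂ q x)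

  _≈OpenPair_ : OpenPair → OpenPair → Set c
  p ≈OpenPair q = (∀ x → OpenPair.U₁ p x ≡ OpenPair.U₁ q x) × (∀ x → OpenPair.U₂ p x ≡ OpenPair.U₂ q x)

  Map3-Plotkin : PlotkinSig (c ⊔ ℓ₁ ⊔ ℓ₂ ⊔ lsuc ι) c c
  Map3-Plotkin = record
    { Carrier = Map3
    ; _≈_ = _≈Map3_
    ; _≤_ = λ f g → ∀ x → Map3.fun f x ≤₃ Map3.fun g x
    ; 𝟘 = mkMap3 (λ _ → zero₃) (const-continuous X 𝟛-poset zero₃)
    ; 𝟙 = mkMap3 (λ _ → one₃) (const-continuous X 𝟛-poset one₃)
    ; ⋈ = mkMap3 (λ _ → bowtie) (const-continuous X 𝟛-poset bowtie)
    ; _⨿_ = λ f g → mkMap3 (λ x → Map3.fun f x ⨿₃ Map3.fun g x)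
                           (⨿-continuous X (Map3.continuous f) (Map3.continuous g))
    }

  OpenPair-Plotkin : PlotkinSig (c ⊔ ℓ₁ ⊔ ℓ₂ ⊔ lsuc ι) c c
  OpenPair-Plotkin = record
    { Carrier = OpenPair
    ; _≈_ = _≈OpenPair_
    ; _≤_ = λ p q → (∀ x → OpenPair.U₁ p x ≡ true → OpenPair.U₁ q x ≡ true)
                  × (∀ x → OpenPair.U₂ p x ≡ true → OpenPair.U₂ q x ≡ true)
    ; 𝟘 = mkOpenPair (λ _ → false) (λ _ → false) (∅-open X) (∅-open X) (λ _ p → p)
    ; 𝟙 = mkOpenPair (λ _ → true) (λ _ → true) (X-open X) (X-open X) (λ _ p → p)
    ; ⋈ = mkOpenPair (λ _ → true) (λ _ → false) (X-open X) (∅-open X) (λ _ _ → refl)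
    ; _⨿_ = λ p q → mkOpenPair
        (λ x → OpenPair.U₁ p x ∨ OpenPair.U₁ q x) (λ x → OpenPair.U₂ p x ∧ OpenPair.U₂ q x)
        (∪-open X (OpenPair.U₁-open p) (OpenPair.U₁-open q))
        (∩-open X (OpenPair.U₂-open p) (OpenPair.U₂-open q))
        (∪∩-incl X {OpenPair.U₁ p} {OpenPair.U₂ p} {OpenPair.U₁ q} {OpenPair.U₂ q}
                   (OpenPair.U₂⊆U₁ p) (OpenPair.U₂⊆U₁ q))
    }

-- The argument is order theory on the finite posets 2 and 3.
--  * Left adjoints preserve all joins, so post-composing a Scott continuous
--    map with a left adjoint keeps it Scott continuous; pairing two Scott
--    continuous maps gives a Scott continuous map into the product poset.
--  * The maps nonzero₃, isOne₃ : 3 → 2 are left adjoints, and so is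
--    decode : 2 × 2 → 3, (a , b) ↦ 1 if b, ⋈ if a ∧ ¬b, 0 otherwise.
--    Hence f ↦ (nonzero₃ ∘ f , isOne₃ ∘ f) and (g₁ , g₂) ↦ decode ∘ ⟨g₁,g₂⟩
--    preserve Scott continuity; they are mutually inverse (on pairs with
--    g₂ ≤ g₁) because a ↦ (nonzero₃ a , isOne₃ a) is a section of decode.
--  * A map g : X → 2 is Scott continuous iff g⁻¹(1) is Scott open
--    (classically: the hard direction uses excluded middle).
--  * The Plotkin structure is preserved pointwise, because nonzero₃ and
--    isOne₃ turn ⨿₃ into ∨ and ∧, and jointly reflect the order of 3.
module Submission where

open import Defs
open import Data.Product using (Σ; _×_; _,_; proj₁; proj₂)
open import Data.Product.Relation.Binary.Pointwise.NonDependent using (×-poset)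
open import Relation.Binary.Bundles using (Poset)
open import Relation.Binary.Definitions using (Adjoint)
open import Relation.Binary.PropositionalEquality using (_≡_; refl; sym; cong; cong₂; subst₂; module ≡-Reasoning)
open import Level using (_⊔_; 0ℓ; Lift; lift; lower)
open import Axiom.ExcludedMiddle using (ExcludedMiddle)
open import Data.Bool using (Bool; true; false; _∨_; _∧_; f≤t; b≤b) renaming (_≤_ to _≤B_)
open import Data.Bool.Properties using (≤-minimum; ≤-maximum) renaming (≤-poset to 𝟚-poset)
open import Relation.Nullary using (yes; no; ¬_; contradiction)
open import Relation.Nullary.Decidable using (map′)

-- Excluded middle at a level implies it at every lower level; the theorem
-- assumes it at c ⊔ ℓ₁ ⊔ ℓ₂ ⊔ ι, the open-set lemma needs it at ι only.
lowerEM : ∀ {a} b → ExcludedMiddle (a ⊔ b) → ExcludedMiddle a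
lowerEM b em = map′ lower lift (em {Lift b _})

module _ {c ℓ₁ ℓ₂ c' ℓ₁' ℓ₂'} (P : Poset c ℓ₁ ℓ₂) (Q : Poset c' ℓ₁' ℓ₂')
         {h : Poset.Carrier P → Poset.Carrier Q} {k : Poset.Carrier Q → Poset.Carrier P}
         (h⊣k : Adjoint (Poset._≤_ P) (Poset._≤_ Q) h k) where
  private
    module P = Poset P
    module Q = Poset Q

  -- x ≤ y ≤ k (h y), hence h x ≤ h y
  leftAdjoint-monotone : ∀ {x y} → x P.≤ y → h x Q.≤ h y
  leftAdjoint-monotone x≤y = proj₂ h⊣k (P.trans x≤y (proj₁ h⊣k Q.refl))

  leftAdjoint-preserves-lub : ∀ {ι} {I : Set ι} (d : I → P.Carrier) s →
                              IsLub P d s → IsLub Q (λ i → h (d i)) (h s)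
  leftAdjoint-preserves-lub d s (d≤s , least) =
      (λ i → leftAdjoint-monotone (d≤s i))
    , (λ u hd≤u → proj₂ h⊣k (least (k u) (λ i → proj₁ h⊣k (hd≤u i))))

module _ {c ℓ₁ ℓ₂ ι} (X : Dcpo c ℓ₁ ℓ₂ ι) where

  leftAdjoint-∘-continuous :
    ∀ {c' ℓ₁' ℓ₂' c'' ℓ₁'' ℓ₂''} (P : Poset c' ℓ₁' ℓ₂') (Q : Poset c'' ℓ₁'' ℓ₂'')
      {f : Dcpo.Carrier X → Poset.Carrier P} {h : Poset.Carrier P → Poset.Carrier Q} {k} →
    Adjoint (Poset._≤_ P) (Poset._≤_ Q) h k →
    ScottContinuous X P f → ScottContinuous X Q (λ x → h (f x))
  leftAdjoint-∘-continuous P Q h⊣k fc d dir s lub =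
    leftAdjoint-preserves-lub P Q h⊣k _ _ (fc d dir s lub)

  -- joins in a product poset are computed componentwise
  pairing-continuous :
    ∀ {c' ℓ₁' ℓ₂' c'' ℓ₁'' ℓ₂''} (P : Poset c' ℓ₁' ℓ₂') (Q : Poset c'' ℓ₁'' ℓ₂'')
      {f : Dcpo.Carrier X → Poset.Carrier P} {g : Dcpo.Carrier X → Poset.Carrier Q} →
    ScottContinuous X P f → ScottContinuous X Q g →
    ScottContinuous X (×-poset P Q) (λ x → f x , g x)
  pairing-continuous P Q fc gc d dir s lub =
      (λ i → proj₁ F i , proj₁ G i)
    , (λ { (u , v) ub → proj₂ F u (λ i → proj₁ (ub i)) , proj₂ G v (λ i → proj₂ (ub i)) })
    where
      F = fc d dir s lub
      G = gc d dir s lub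

-- the order of 2 is implication between memberships, so 2-valued maps
-- and subsets (as characteristic functions) carry the same order
≤B⇒⊆ : ∀ {a b} → a ≤B b → a ≡ true → b ≡ true
≤B⇒⊆ b≤b p = p
≤B⇒⊆ f≤t _ = refl

⊆⇒≤B : ∀ a b → (a ≡ true → b ≡ true) → a ≤B b
⊆⇒≤B false b _ = ≤-minimum b
⊆⇒≤B true b a⊆b with a⊆b refl
... | refl = b≤b

≤false⇒≢true : ∀ {a} → a ≤B false → ¬ (a ≡ true)
≤false⇒≢true b≤b ()

module _ {c ℓ₁ ℓ₂ ι} (X : Dcpo c ℓ₁ ℓ₂ ι) where
  private module X = Dcpo X

  -- g⁻¹(1) is Scott open for Scott continuous g : X → 2.  Inaccessibility is
  -- classical: if no d i lies in g⁻¹(1) then false bounds the family, so g s = false.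
  continuous⇒open : ExcludedMiddle ι → ∀ {g} → ScottContinuous X 𝟚-poset g → IsScottOpen X g
  continuous⇒open em {g} gc = record
    { upper = λ x≤y → ≤B⇒⊆ (continuous⇒monotone X 𝟚-poset gc x≤y)
    ; inaccessible = inaccessible }
    where
      inaccessible : ∀ {I : Set ι} (d : I → X.Carrier) → IsDirected X.poset d →
                     ∀ s → IsLub X.poset d s → g s ≡ true → Σ I (λ i → g (d i) ≡ true)
      inaccessible {I} d dir s lub gs with em {Σ I (λ i → g (d i) ≡ true)}
      ... | yes hit = hit
      ... | no none = contradiction gs (≤false⇒≢true (proj₂ (gc d dir s lub) false gd≤false))
        where
          gd≤false : ∀ i → g (d i) ≤B false
          gd≤false i = ⊆⇒≤B (g (d i)) false (λ gi → contradiction (i , gi) none)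

  open⇒continuous : ∀ {U} → IsScottOpen X U → ScottContinuous X 𝟚-poset U
  open⇒continuous {U} Uo d dir s lub@(d≤s , _) =
    (λ i → ⊆⇒≤B _ _ (IsScottOpen.upper Uo (d≤s i))) , least
    where
      least : ∀ u → (∀ i → U (d i) ≤B u) → U s ≤B u
      least true _ = ≤-maximum _
      least false Ud≤false = ⊆⇒≤B (U s) false λ Us →
        let (i , Udi) = IsScottOpen.inaccessible Uo d dir s lub Us
        in ≤B⇒⊆ (Ud≤false i) Udi

𝟚×𝟚-poset : Poset 0ℓ 0ℓ 0ℓ
𝟚×𝟚-poset = ×-poset 𝟚-poset 𝟚-poset

≤1 : ∀ {x} → x ≤₃ one₃
≤1 {zero₃} = 0≤1
≤1 {bowtie} = ⋈≤1
≤1 {one₃} = 1≤1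

-- reading a pair (a , b) = ([x ≠ 0] , [x = 1]) back as an element x of 3;
-- defined on all of 2 × 2 so that it is a left adjoint
decode : Bool × Bool → Three
decode (_ , true) = one₃
decode (false , false) = zero₃
decode (true , false) = bowtie

nonzero₃-adjoint : Adjoint _≤₃_ _≤B_ nonzero₃ (λ { false → zero₃ ; true → one₃ })
nonzero₃-adjoint {_} {true} = (λ _ → ≤1) , (λ _ → ≤-maximum _)
nonzero₃-adjoint {zero₃} {false} = (λ _ → 0≤0) , (λ _ → b≤b)
nonzero₃-adjoint {bowtie} {false} = (λ ()) , (λ ())
nonzero₃-adjoint {one₃} {false} = (λ ()) , (λ ())

isOne₃-adjoint : Adjoint _≤₃_ _≤B_ isOne₃ (λ { false → bowtie ; true → one₃ })
isOne₃-adjoint {_} {true} = (λ _ → ≤1) , (λ _ → ≤-maximum _)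
isOne₃-adjoint {zero₃} {false} = (λ _ → 0≤⋈) , (λ _ → b≤b)
isOne₃-adjoint {bowtie} {false} = (λ _ → ⋈≤⋈) , (λ _ → b≤b)
isOne₃-adjoint {one₃} {false} = (λ ()) , (λ ())

decode-adjoint : Adjoint (Poset._≤_ 𝟚×𝟚-poset) _≤₃_ decode
                   (λ { zero₃ → false , false ; bowtie → true , false ; one₃ → true , true })
decode-adjoint {a , b} {one₃} = (λ _ → ≤-maximum a , ≤-maximum b) , (λ _ → ≤1)
decode-adjoint {false , false} {bowtie} = (λ _ → f≤t , b≤b) , (λ _ → 0≤⋈)
decode-adjoint {true , false} {bowtie} = (λ _ → b≤b , b≤b) , (λ _ → ⋈≤⋈)
decode-adjoint {_ , true} {bowtie} = (λ ()) , (λ { (_ , ()) })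
decode-adjoint {false , false} {zero₃} = (λ _ → b≤b , b≤b) , (λ _ → 0≤0)
decode-adjoint {true , false} {zero₃} = (λ ()) , (λ { (() , _) })
decode-adjoint {_ , true} {zero₃} = (λ ()) , (λ { (_ , ()) })

decode-code : ∀ a → decode (nonzero₃ a , isOne₃ a) ≡ a
decode-code zero₃ = refl
decode-code bowtie = refl
decode-code one₃ = refl

code-decode : ∀ {a b} → b ≤B a → nonzero₃ (decode (a , b)) ≡ a × isOne₃ (decode (a , b)) ≡ b
code-decode {false} b≤b = refl , refl
code-decode {true} {false} _ = refl , refl
code-decode {true} {true} _ = refl , refl

isOne₃≤nonzero₃ : ∀ a → isOne₃ a ≤B nonzero₃ a
isOne₃≤nonzero₃ zero₃ = b≤b
isOne₃≤nonzero₃ bowtie = f≤t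
isOne₃≤nonzero₃ one₃ = b≤b

code-injective : ∀ a b → nonzero₃ a ≡ nonzero₃ b → isOne₃ a ≡ isOne₃ b → a ≡ b
code-injective a b p q = begin
  a                               ≡⟨ sym (decode-code a) ⟩
  decode (nonzero₃ a , isOne₃ a)  ≡⟨ cong₂ (λ u v → decode (u , v)) p q ⟩
  decode (nonzero₃ b , isOne₃ b)  ≡⟨ decode-code b ⟩
  b                               ∎
  where open ≡-Reasoning

code-reflects : ∀ a b → nonzero₃ a ≤B nonzero₃ b → isOne₃ a ≤B isOne₃ b → a ≤₃ b
code-reflects a b p q =
  subst₂ _≤₃_ (decode-code a) (decode-code b)
         (leftAdjoint-monotone 𝟚×𝟚-poset 𝟛-poset decode-adjoint (p , q))

nonzero₃-⨿ : ∀ a b → nonzero₃ (a ⨿₃ b) ≡ (nonzero₃ a ∨ nonzero₃ b)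
nonzero₃-⨿ zero₃ zero₃ = refl
nonzero₃-⨿ zero₃ bowtie = refl
nonzero₃-⨿ zero₃ one₃ = refl
nonzero₃-⨿ bowtie _ = refl
nonzero₃-⨿ one₃ zero₃ = refl
nonzero₃-⨿ one₃ bowtie = refl
nonzero₃-⨿ one₃ one₃ = refl

isOne₃-⨿ : ∀ a b → isOne₃ (a ⨿₃ b) ≡ (isOne₃ a ∧ isOne₃ b)
isOne₃-⨿ zero₃ zero₃ = refl
isOne₃-⨿ zero₃ bowtie = refl
isOne₃-⨿ zero₃ one₃ = refl
isOne₃-⨿ bowtie zero₃ = refl
isOne₃-⨿ bowtie bowtie = refl
isOne₃-⨿ bowtie one₃ = refl
isOne₃-⨿ one₃ zero₃ = refl
isOne₃-⨿ one₃ bowtie = refl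
isOne₃-⨿ one₃ one₃ = refl

module _ {c ℓ₁ ℓ₂ ι} (X : Dcpo c ℓ₁ ℓ₂ ι) where
  open Map3
  open Pair2
  open OpenPair

  toPair2 : Map3 X → Pair2 X
  toPair2 f = mkPair2 (λ x → nonzero₃ (fun f x)) (λ x → isOne₃ (fun f x))
    (leftAdjoint-∘-continuous X 𝟛-poset 𝟚-poset nonzero₃-adjoint (continuous f))
    (leftAdjoint-∘-continuous X 𝟛-poset 𝟚-poset isOne₃-adjoint (continuous f))
    (λ x → isOne₃≤nonzero₃ (fun f x))

  fromPair2 : Pair2 X → Map3 X
  fromPair2 p = mkMap3 (λ x → decode (g₁ p x , g₂ p x))
    (leftAdjoint-∘-continuous X 𝟚×𝟚-poset 𝟛-poset decode-adjoint
      (pairing-continuous X 𝟚-poset 𝟚-poset (g₁-continuous p) (g₂-continuous p)))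

  toPair2-bijective : Bijective (_≈Map3_ X) (_≈Pair2_ X) toPair2
  toPair2-bijective = record
    { cong = λ f≈g → (λ x → cong nonzero₃ (f≈g x)) , (λ x → cong isOne₃ (f≈g x))
    ; injective = λ {f} {g} (e₁ , e₂) x → code-injective (fun f x) (fun g x) (e₁ x) (e₂ x)
    ; surjective = λ p → fromPair2 p
        , (λ x → proj₁ (code-decode (g₂≤g₁ p x)))
        , (λ x → proj₂ (code-decode (g₂≤g₁ p x))) }

  module _ (em : ExcludedMiddle ι) where

    toOpenPair : Pair2 X → OpenPair X
    toOpenPair p = mkOpenPair (g₁ p) (g₂ p)
      (continuous⇒open X em (g₁-continuous p)) (continuous⇒open X em (g₂-continuous p))
      (λ x → ≤B⇒⊆ (g₂≤g₁ p x))

    fromOpenPair : OpenPair X → Pair2 X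
    fromOpenPair o = mkPair2 (U₁ o) (U₂ o)
      (open⇒continuous X (U₁-open o)) (open⇒continuous X (U₂-open o))
      (λ x → ⊆⇒≤B (U₂ o x) (U₁ o x) (U₂⊆U₁ o x))

    -- toOpenPair keeps the underlying characteristic functions
    toOpenPair-bijective : Bijective (_≈Pair2_ X) (_≈OpenPair_ X) toOpenPair
    toOpenPair-bijective = record
      { cong = λ p≈q → p≈q
      ; injective = λ p≈q → p≈q
      ; surjective = λ o → fromOpenPair o , (λ _ → refl) , (λ _ → refl) }

    toOpenPair₃ : Map3 X → OpenPair X
    toOpenPair₃ f = toOpenPair (toPair2 f)

    -- as toOpenPair keeps the characteristic functions, ≈OpenPair between
    -- toOpenPair₃-images is ≈Pair2 between toPair2-images
    toOpenPair₃-isPlotkinIso : IsPlotkinIso (Map3-Plotkin X) (OpenPair-Plotkin X) toOpenPair₃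
    toOpenPair₃-isPlotkinIso = record
      { bijective = record
        { cong = λ {f} {g} → Bijective.cong toPair2-bijective {f} {g}
        ; injective = λ {f} {g} → Bijective.injective toPair2-bijective {f} {g}
        ; surjective = λ o → Bijective.surjective toPair2-bijective (fromOpenPair o) }
      ; monotone = λ f≤g →
            (λ x → ≤B⇒⊆ (leftAdjoint-monotone 𝟛-poset 𝟚-poset nonzero₃-adjoint (f≤g x)))
          , (λ x → ≤B⇒⊆ (leftAdjoint-monotone 𝟛-poset 𝟚-poset isOne₃-adjoint (f≤g x)))
      ; reflecting = λ {f} {g} (nz⊆ , one⊆) x → code-reflects (fun f x) (fun g x)
          (⊆⇒≤B _ _ (nz⊆ x)) (⊆⇒≤B _ _ (one⊆ x))
      ; pres-𝟘 = (λ _ → refl) , (λ _ → refl)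
      ; pres-𝟙 = (λ _ → refl) , (λ _ → refl)
      ; pres-⋈ = (λ _ → refl) , (λ _ → refl)
      ; pres-⨿ = λ f g → (λ x → nonzero₃-⨿ (fun f x) (fun g x))
                       , (λ x → isOne₃-⨿ (fun f x) (fun g x)) }

lemma4p4 : ∀ {c ℓ₁ ℓ₂ ι} →
    ExcludedMiddle (c ⊔ ℓ₁ ⊔ ℓ₂ ⊔ ι) →
    (X : Dcpo c ℓ₁ ℓ₂ ι) →
    Σ (Map3 X → Pair2 X) (λ ψ →
        Bijective (_≈Map3_ X) (_≈Pair2_ X) ψ
      × (∀ f x → Pair2.g₁ (ψ f) x ≡ nonzero₃ (Map3.fun f x))
      × (∀ f x → Pair2.g₂ (ψ f) x ≡ isOne₃ (Map3.fun f x)))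
    × Σ (Pair2 X → OpenPair X) (λ χ →
        Bijective (_≈Pair2_ X) (_≈OpenPair_ X) χ
      × (∀ p x → OpenPair.U₁ (χ p) x ≡ Pair2.g₁ p x)
      × (∀ p x → OpenPair.U₂ (χ p) x ≡ Pair2.g₂ p x))
    × Σ (Map3 X → OpenPair X) (λ φ →
        IsPlotkinIso (Map3-Plotkin X) (OpenPair-Plotkin X) φ
      × (∀ f x → OpenPair.U₁ (φ f) x ≡ nonzero₃ (Map3.fun f x))
      × (∀ f x → OpenPair.U₂ (φ f) x ≡ isOne₃ (Map3.fun f x)))
lemma4p4 {c} {ℓ₁} {ℓ₂} em X =
    (toPair2 X , toPair2-bijective X , (λ _ _ → refl) , (λ _ _ → refl))
  , (toOpenPair X emι , toOpenPair-bijective X emι , (λ _ _ → refl) , (λ _ _ → refl))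
  , (toOpenPair₃ X emι , toOpenPair₃-isPlotkinIso X emι , (λ _ _ → refl) , (λ _ _ → refl))
  where
    emι = lowerEM (c ⊔ ℓ₁ ⊔ ℓ₂) em
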